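{- With the notation of the context: (i) For $\alpha\in\mathbb{F}_q$, $\sum_{a\in\mathbb{F}_q\cup\{y\}}C_{a,\alpha}=q\, I_q\otimes \phi(\alpha)+(J_q+\phi(\alpha)-I_q)\otimes J_q$. (ii) For $a\in\mathbb{F}_q\cup\{y\}$ and $\alpha,\alpha'\in\mathbb{F}_q$, $C_{a,\alpha}C_{a,\alpha'}=q\, C_{a,\alpha+\alpha'}$. (iii) For distinct $a,a'\in\mathbb{F}_q\cup\{y\}$ and $\alpha,\alpha'\in\mathbb{F}_q$, $C_{a,\alpha}C_{a',\alpha'}=J_{q^2}$. (iv) For $\alpha,\alpha',\alpha''\in\mathbb{F}_q$, $(I_q\otimes \phi(\alpha''))C_{\alpha,\alpha'}=C_{\alpha,\alpha'+\alpha''}$. (v) For $\alpha,\alpha'\in\mathbb{F}_q$, $(I_q\otimes \phi(\alpha))C_{y,\alpha'}=C_{y,\alpha'}$. (vi) $\sum_{a,b\in \mathbb{F}_q\cup\{y\},\,a\neq b} P_{a}P_{b}=q(J_{q+2}-I_{q+2})$.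
   Context: Let $m\ge1$, $q=2^m$, $\mathbb{F}_q$ the field with $q$ elements. Fix an $\mathbb{F}_2$-linear identification of $(\mathbb{F}_q,+)$ with $\mathbb{F}_2^m$. All matrices are indexed by finite sets; for $A$ indexed by $X$ and $B$ by $Y$, $A\otimes B$ is indexed by $X\times Y$ with $((u,v),(u',v'))$-entry $A_{u,u'}B_{v,v'}$. $I_q,J_q$ (identity, all-ones) are indexed by $\mathbb{F}_q$; $J_{q^2},O_{q^2}$ (all-ones, zero) by $\mathbb{F}_q\times\mathbb{F}_q$. For $\alpha\in\mathbb{F}_q$, $\phi(\alpha)$ is the permutation matrix indexed by $\mathbb{F}_q$ with $(\gamma,\gamma')$-entry $1$ iff $\gamma+\gamma'=\alpha$ (equivalently $\otimes_{i=1}^mR^{\alpha_i}$ with $R=J_2-I_2$). For $\alpha,\alpha'\in\mathbb{F}_q$, $C_{\alpha,\alpha'}$ is the matrix indexed by $\mathbb{F}_q\times\mathbb{F}_q$ with $((\beta,\gamma),(\beta',\gamma'))$-entry equal to the $(\gamma,\gamma')$-entry of $\phi(\alpha(-\beta+\beta')+\alpha')$ (the block matrix $(\phi(\alpha(-\beta+\beta')+\alpha'))_{\beta,\beta'\in\mathbb{F}_q}$). For new symbols $x,y$: $C_{x,\alpha}=O_{q^2}$, $C_{y,\alpha}=\phi(\alpha)\otimes J_q$. Let $S=\mathbb{F}_q\cup\{x,y\}$ and $L=(L(a,a'))_{a,a'\in S}$ a symmetric Latin square on symbol set $S$ with $L(a,a)=x$ for all $a\in S$. For $a\in S$, $P_a$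 is the matrix indexed by $S$ with $(b,b')$-entry $1$ iff $L(b,b')=a$; $I_{q+2},J_{q+2}$ are the identity and all-ones matrices indexed by $S$. -}

module Defs where

open import Data.Nat using (ℕ; zero; suc; _+_; _*_; _∸_; _^_)
open import Data.Bool using (Bool; true; false; if_then_else_)
open import Data.Product using (_×_; _,_; ∃; Σ)
open import Data.List using (List; []; _∷_; _++_; map; length; cartesianProduct)
open import Data.List.Membership.Propositional using (_∈_)
open import Data.List.Relation.Unary.Unique.Propositional using (Unique)
open import Relation.Nullary using (¬_; Dec; yes; no)
open import Relation.Nullary.Decidable using (⌊_⌋)
open import Relation.Binary.PropositionalEquality using (_≡_; _≢_; refl; cong)
open import Relation.Binary.Definitions using (DecidableEquality)
open import Algebra.Structures using (IsCommutativeRing)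

record FiniteField2^ (m : ℕ) : Set₁ where
  infixl 6 _+F_
  infixl 7 _*F_
  field
    F       : Set
    _+F_    : F → F → F
    _*F_    : F → F → F
    -F_     : F → F
    0F      : F
    1F      : F
    isCommutativeRing : IsCommutativeRing _≡_ _+F_ _*F_ -F_ 0F 1F
    0≢1     : 0F ≢ 1F
    inverse : ∀ a → a ≢ 0F → ∃ λ b → a *F b ≡ 1F
    _≟F_    : DecidableEquality F
    elems   : List F
    elems-unique   : Unique elems
    elems-complete : ∀ a → a ∈ elems
    card    : length elems ≡ 2 ^ m
    -- characteristic 2 (a consequence of |F| = 2^m, recorded explicitly)
    char2   : 1F +F 1F ≡ 0F

sumL : {A : Set} → List A → (A → ℕ) → ℕ
sumL []       f = 0
sumL (a ∷ as) f = f a + sumL as f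

Mat : Set → Set
Mat X = X → X → ℕ

_≋_ : {X : Set} → Mat X → Mat X → Set
A ≋ B = ∀ i j → A i j ≡ B i j

infix 4 _≋_
infixl 6 _⊕_ _⊖_
infixl 7 _·_ _⊗_

_⊕_ : {X : Set} → Mat X → Mat X → Mat X
(A ⊕ B) i j = A i j + B i j

-- entrywise truncated subtraction (only used where the result is nonnegative)
_⊖_ : {X : Set} → Mat X → Mat X → Mat X
(A ⊖ B) i j = A i j ∸ B i j

_·_ : {X : Set} → ℕ → Mat X → Mat X
(c · A) i j = c * A i j

mmul : {X : Set} → List X → Mat X → Mat X → Mat X
mmul xs A B i j = sumL xs (λ k → A i k * B k j)

msum : {A X : Set} → List A → (A → Mat X) → Mat X
msum as M i j = sumL as (λ a → M a i j)

_⊗_ : {X Y : Set} → Mat X → Mat Y → Mat (X × Y)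
(A ⊗ B) (u , v) (u' , v') = A u u' * B v v'

Iₘ : {X : Set} → DecidableEquality X → Mat X
Iₘ _≟_ i j = if ⌊ i ≟ j ⌋ then 1 else 0

Jₘ : {X : Set} → Mat X
Jₘ i j = 1

Oₘ : {X : Set} → Mat X
Oₘ i j = 0

data Sym (F : Set) : Set where
  fq : F → Sym F
  x  : Sym F
  y  : Sym F

fq-injective : {F : Set} {a b : F} → fq a ≡ fq b → a ≡ b
fq-injective refl = refl

decSym : {F : Set} → DecidableEquality F → DecidableEquality (Sym F)
decSym d (fq a) (fq b) with d a b
... | yes refl = yes refl
... | no ne    = no (λ e → ne (fq-injective e))
decSym d (fq a) x = no (λ ())
decSym d (fq a) y = no (λ ())
decSym d x (fq b) = no (λ ())
decSym d x x = yes refl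
decSym d x y = no (λ ())
decSym d y (fq b) = no (λ ())
decSym d y x = no (λ ())
decSym d y y = yes refl

IsLatinSquare : {S : Set} → (S → S → S) → Set
IsLatinSquare {S} L =
  (∀ b a → ∃ λ b' → L b b' ≡ a × (∀ b'' → L b b'' ≡ a → b'' ≡ b')) ×
  (∀ b' a → ∃ λ b → L b b' ≡ a × (∀ b'' → L b'' b' ≡ a → b'' ≡ b))

module Construction {m : ℕ} (𝔽 : FiniteField2^ m) where
  open FiniteField2^ 𝔽

  q : ℕ
  q = 2 ^ m

  elems² : List (F × F)
  elems² = cartesianProduct elems elems

  _≟²_ : DecidableEquality (F × F)
  (a , b) ≟² (c , d) with a ≟F c | b ≟F d
  ... | yes refl | yes refl = yes refl
  ... | no ne    | _        = no (λ { refl → ne refl })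
  ... | yes _    | no ne    = no (λ { refl → ne refl })

  Sq : Set
  Sq = Sym F

  _≟S_ : DecidableEquality Sq
  _≟S_ = decSym _≟F_

  elemsS : List Sq
  elemsS = map fq elems ++ (x ∷ y ∷ [])

  elemsFy : List Sq
  elemsFy = map fq elems ++ (y ∷ [])

  I_q : Mat F
  I_q = Iₘ _≟F_

  J_q : Mat F
  J_q = Jₘ

  J_q² : Mat (F × F)
  J_q² = Jₘ

  O_q² : Mat (F × F)
  O_q² = Oₘ

  I_S : Mat Sq
  I_S = Iₘ _≟S_

  J_S : Mat Sq
  J_S = Jₘ

  φ : F → Mat F
  φ α γ γ' = if ⌊ (γ +F γ') ≟F α ⌋ then 1 else 0

  C : Sq → F → Mat (F × F)
  C (fq α) α' (β , γ) (β' , γ') = φ ((α *F ((-F β) +F β')) +F α') γ γ'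
  C x α = O_q²
  C y α = φ α ⊗ J_q

  _∙²_ : Mat (F × F) → Mat (F × F) → Mat (F × F)
  A ∙² B = mmul elems² A B

  _∙S_ : Mat Sq → Mat Sq → Mat Sq
  A ∙S B = mmul elemsS A B

  P : (Sq → Sq → Sq) → Sq → Mat Sq
  P L a b b' = if ⌊ L b b' ≟S a ⌋ then 1 else 0

  ΣPP : (Sq → Sq → Sq) → Mat Sq
  ΣPP L = msum elemsFy (λ a → msum elemsFy (λ b →
            if ⌊ a ≟S b ⌋ then Oₘ else (P L a ∙S P L b)))

-- In characteristic 2 the indicator [a = b] equals [a + b = 0], so φ(α)_{γγ'} = [γ + γ' + α = 0]
-- and φ is a homomorphism from (F_q, +) to permutation matrices: φ(s)φ(t) = φ(s + t) and
-- φ(s)J = Jφ(s) = J. The matrices in (i)-(v) are q × q block matrices whose blocks are φ(·),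
-- φ(·)J or [β = β']φ(·), so their products are computed blockwise; the one further count is that
-- e b + r = 0 with e ≠ 0 has exactly one solution b, which yields J in (iii) and the off-diagonal
-- blocks in (i). For (vi), summing over the middle index w first, the (u,v) entry counts the w for
-- which L(u,w) and L(w,v) are distinct and both differ from x: none when u = v, by symmetry of L,
-- and every w other than u and v when u ≠ v, by the Latin property.

module Submission where

open import Defs
open import Algebra.Bundles using (CommutativeRing; RawRing)
open import Algebra.Structures using (IsCommutativeRing)
open import Algebra.Solver.Ring.AlmostCommutativeRing using (fromCommutativeRing; _-Raw-AlmostCommutative⟶_)
open import Data.Bool using (Bool; true; false; _xor_; _∧_; if_then_else_)
import Data.Bool.Properties as Bool
open import Data.List using (List; []; _∷_; _++_; map; length; cartesianProduct)
open import Data.List.Membership.Propositional using (_∈_)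
open import Data.List.Membership.Propositional.Properties using (∈-map⁺; ∈-map⁻; ∈-++⁺ˡ; ∈-++⁺ʳ; ∈-++⁻)
open import Data.List.Properties using (length-++; length-map)
open import Data.List.Relation.Unary.All as All using ([]; _∷_)
open import Data.List.Relation.Unary.AllPairs using ([]; _∷_)
open import Data.List.Relation.Unary.Any using (here; there)
open import Data.List.Relation.Unary.Unique.Propositional using (Unique)
import Data.List.Relation.Unary.Unique.Propositional.Properties as Unique
open import Data.Maybe using () renaming (map to mapMaybe)
open import Data.Nat using (ℕ; _≤_; _+_; _*_; _∸_)
import Data.Nat.Properties as ℕ
open import Algebra.Properties.CommutativeSemigroup ℕ.+-commutativeSemigroup
  using () renaming (interchange to +-interchange)
open import Algebra.Properties.CommutativeSemigroup ℕ.*-commutativeSemigroup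
  using () renaming (x∙yz≈y∙xz to x*[y*z]≡y*[x*z]; x∙yz≈z∙xy to x*[y*z]≡z*[x*y])
open import Data.Product using (_×_; _,_; proj₁; proj₂)
open import Data.Sum using (inj₁; inj₂)
open import Function using (id; _∘_)
open import Relation.Binary.Definitions using (DecidableEquality)
open import Relation.Binary.PropositionalEquality using (_≡_; _≢_; refl; sym; trans; cong; cong₂; module ≡-Reasoning)
open import Relation.Nullary using (yes; no)
open import Relation.Nullary.Decidable using (⌊_⌋)
open import Relation.Nullary.Decidable.Core using (dec⇒maybe)
open import Data.Empty using (⊥-elim)

module _ {A : Set} where

  sumL-cong : ∀ xs {f g : A → ℕ} → (∀ a → f a ≡ g a) → sumL xs f ≡ sumL xs g
  sumL-cong []       f≡g = refl
  sumL-cong (a ∷ xs) f≡g = cong₂ _+_ (f≡g a) (sumL-cong xs f≡g)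

  sumL-++ : ∀ xs ys (f : A → ℕ) → sumL (xs ++ ys) f ≡ sumL xs f + sumL ys f
  sumL-++ []       ys f = refl
  sumL-++ (a ∷ xs) ys f = trans (cong (f a +_) (sumL-++ xs ys f)) (sym (ℕ.+-assoc (f a) _ _))

  sumL-+ : ∀ xs (f g : A → ℕ) → sumL xs (λ a → f a + g a) ≡ sumL xs f + sumL xs g
  sumL-+ []       f g = refl
  sumL-+ (a ∷ xs) f g =
    trans (cong (f a + g a +_) (sumL-+ xs f g)) (+-interchange (f a) (g a) _ _)

  sumL-*ˡ : ∀ xs n (f : A → ℕ) → sumL xs (λ a → n * f a) ≡ n * sumL xs f
  sumL-*ˡ []       n f = sym (ℕ.*-zeroʳ n)
  sumL-*ˡ (a ∷ xs) n f = trans (cong (n * f a +_) (sumL-*ˡ xs n f)) (sym (ℕ.*-distribˡ-+ n (f a) _))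

  sumL-const : ∀ (xs : List A) n → sumL xs (λ _ → n) ≡ length xs * n
  sumL-const []       n = refl
  sumL-const (a ∷ xs) n = cong (n +_) (sumL-const xs n)

  sumL-vanishing : ∀ xs (f : A → ℕ) → (∀ a → a ∈ xs → f a ≡ 0) → sumL xs f ≡ 0
  sumL-vanishing []       f f≡0 = refl
  sumL-vanishing (a ∷ xs) f f≡0 =
    cong₂ _+_ (f≡0 a (here refl)) (sumL-vanishing xs f (λ b b∈xs → f≡0 b (there b∈xs)))

  sumL-delta : ∀ {xs} (f : A → ℕ) {c} → Unique xs → c ∈ xs → (∀ a → a ≢ c → f a ≡ 0) →
               sumL xs f ≡ f c
  sumL-delta f (c∉xs ∷ _) (here refl) f≡0 =
    trans (cong (f _ +_) (sumL-vanishing _ f (λ a a∈xs → f≡0 a (λ { refl → All.lookup c∉xs a∈xs refl }))))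
          (ℕ.+-identityʳ _)
  sumL-delta f (a∉xs ∷ unique) (there c∈xs) f≡0 =
    cong₂ _+_ (f≡0 _ (λ { refl → All.lookup a∉xs c∈xs refl })) (sumL-delta f unique c∈xs f≡0)

sumL-map : {A B : Set} (g : A → B) (xs : List A) (f : B → ℕ) → sumL (map g xs) f ≡ sumL xs (f ∘ g)
sumL-map g []       f = refl
sumL-map g (a ∷ xs) f = cong (f (g a) +_) (sumL-map g xs f)

module _ {A B : Set} where

  sumL-cartesianProduct : ∀ xs ys (f : A × B → ℕ) →
    sumL (cartesianProduct xs ys) f ≡ sumL xs (λ a → sumL ys (λ b → f (a , b)))
  sumL-cartesianProduct []       ys f = refl
  sumL-cartesianProduct (a ∷ xs) ys f = trans (sumL-++ (map (a ,_) ys) (cartesianProduct xs ys) f)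
    (cong₂ _+_ (sumL-map (a ,_) ys f) (sumL-cartesianProduct xs ys f))

  sumL-comm : ∀ xs ys (f : A → B → ℕ) →
    sumL xs (λ a → sumL ys (f a)) ≡ sumL ys (λ b → sumL xs (λ a → f a b))
  sumL-comm []       ys f = sym (sumL-vanishing ys _ (λ _ _ → refl))
  sumL-comm (a ∷ xs) ys f = trans (cong (sumL ys (f a) +_) (sumL-comm xs ys f))
    (sym (sumL-+ ys (f a) (λ b → sumL xs (λ a' → f a' b))))

module _ {A : Set} (_≟_ : DecidableEquality A) where

  Iₘ-refl : ∀ a → Iₘ _≟_ a a ≡ 1
  Iₘ-refl a with a ≟ a
  ... | yes _  = refl
  ... | no a≢a = ⊥-elim (a≢a refl)

  Iₘ-≢ : ∀ {a b} → a ≢ b → Iₘ _≟_ a b ≡ 0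
  Iₘ-≢ {a} {b} a≢b with a ≟ b
  ... | yes a≡b = ⊥-elim (a≢b a≡b)
  ... | no _    = refl

  sumL-Iₘ : ∀ {xs} a (f : A → ℕ) → Unique xs → a ∈ xs → sumL xs (λ b → Iₘ _≟_ a b * f b) ≡ f a
  sumL-Iₘ a f unique a∈xs =
    trans (sumL-delta _ unique a∈xs (λ b b≢a → cong (_* f b) (Iₘ-≢ (b≢a ∘ sym))))
          (trans (cong (_* f a) (Iₘ-refl a)) (ℕ.*-identityˡ (f a)))

  sumL-Iₘ-row : ∀ {xs} a → Unique xs → a ∈ xs → sumL xs (Iₘ _≟_ a) ≡ 1
  sumL-Iₘ-row {xs} a unique a∈xs =
    trans (sumL-cong xs (λ b → sym (ℕ.*-identityʳ _))) (sumL-Iₘ a (λ _ → 1) unique a∈xs)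

𝔽₂ : RawRing _ _
𝔽₂ = record
  { Carrier = Bool ; _≈_ = _≡_ ; _+_ = _xor_ ; _*_ = _∧_ ; -_ = id ; 0# = false ; 1# = true }

module Characteristic2
  {F : Set} {_+F_ _*F_ : F → F → F} { -F_ : F → F} {0F 1F : F}
  (isCommutativeRing : IsCommutativeRing _≡_ _+F_ _*F_ -F_ 0F 1F)
  (char2 : (1F +F 1F) ≡ 0F)
  where

  open IsCommutativeRing isCommutativeRing
    using (*-identityˡ; distribʳ; zeroˡ; +-identityˡ; +-identityʳ)

  ring : CommutativeRing _ _
  ring = record { isCommutativeRing = isCommutativeRing }

  open import Algebra.Properties.Group (CommutativeRing.+-group ring) using (inverseʳ-unique)
  open ≡-Reasoning

  x+x≡0 : ∀ a → (a +F a) ≡ 0F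
  x+x≡0 a = begin
    a +F a                    ≡⟨ sym (cong₂ _+F_ (*-identityˡ a) (*-identityˡ a)) ⟩
    (1F *F a) +F (1F *F a)    ≡⟨ sym (distribʳ a 1F 1F) ⟩
    (1F +F 1F) *F a           ≡⟨ cong (_*F a) char2 ⟩
    0F *F a                   ≡⟨ zeroˡ a ⟩
    0F                        ∎

  -x≡x : ∀ a → -F a ≡ a
  -x≡x a = sym (inverseʳ-unique a a (x+x≡0 a))

  x+y≡0⇒x≡y : ∀ {a b} → (a +F b) ≡ 0F → a ≡ b
  x+y≡0⇒x≡y {a} {b} a+b≡0 = trans (sym (-x≡x a)) (sym (inverseʳ-unique a b a+b≡0))

  ⟦_⟧ : Bool → F
  ⟦ true  ⟧ = 1F
  ⟦ false ⟧ = 0F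

  -- F is an 𝔽₂-algebra, so the ring solver run with 𝔽₂ coefficients also proves identities
  -- that rely on 1 + 1 = 0.
  𝔽₂-algebra : 𝔽₂ -Raw-AlmostCommutative⟶ fromCommutativeRing ring
  𝔽₂-algebra = record
    { ⟦_⟧    = ⟦_⟧
    ; +-homo = λ { true true → sym char2 ; true false → sym (+-identityʳ _)
                 ; false b → sym (+-identityˡ _) }
    ; *-homo = λ { true b → sym (*-identityˡ _) ; false b → sym (zeroˡ _) }
    ; -‿homo = λ b → sym (-x≡x _)
    ; 0-homo = refl
    ; 1-homo = refl
    }

  open import Algebra.Solver.Ring 𝔽₂ (fromCommutativeRing ring) 𝔽₂-algebra
    (λ a b → mapMaybe (cong ⟦_⟧) (dec⇒maybe (a Bool.≟ b)))
    public using (solve; _:=_; _:+_; _:*_; :-_)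

module _ {X : Set} (xs : List X) (A B : Mat X) where

  mmul-·ˡ : ∀ c i j → mmul xs (c · A) B i j ≡ c * mmul xs A B i j
  mmul-·ˡ c i j = trans (sumL-cong xs (λ k → ℕ.*-assoc c (A i k) (B k j))) (sumL-*ˡ xs c _)

  mmul-·ʳ : ∀ d i j → mmul xs A (d · B) i j ≡ d * mmul xs A B i j
  mmul-·ʳ d i j = trans (sumL-cong xs (λ k → x*[y*z]≡y*[x*z] (A i k) d (B k j))) (sumL-*ˡ xs d _)

-- C (fq α) α', C y α = φ α ⊗ J_q and I_q ⊗ φ α are definitionally of this form, so block-mul
-- applies to them directly.
block : {X Y : Set} → (X → X → Mat Y) → Mat (X × Y)
block M (a , b) (a' , b') = M a a' b b'

block-mul : {X Y : Set} (xs : List X) (ys : List Y) (M N : X → X → Mat Y) → ∀ a b a' b' →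
  mmul (cartesianProduct xs ys) (block M) (block N) (a , b) (a' , b')
    ≡ sumL xs (λ c → mmul ys (M a c) (N c a') b b')
block-mul xs ys M N a b a' b' = sumL-cartesianProduct xs ys _

module FiniteFieldMatrices {m : ℕ} (𝔽 : FiniteField2^ m) where

  open FiniteField2^ 𝔽
  open Construction 𝔽
  open Characteristic2 isCommutativeRing char2
  open IsCommutativeRing isCommutativeRing using (+-assoc; *-assoc; *-comm; *-identityˡ)
  open ≡-Reasoning

  δ₀ : F → ℕ
  δ₀ t = I_q t 0F

  I_q≡δ₀ : ∀ a b → I_q a b ≡ δ₀ (a +F b)
  I_q≡δ₀ a b with a ≟F b | (a +F b) ≟F 0F
  ... | yes refl | yes _     = refl
  ... | yes refl | no a+a≢0  = ⊥-elim (a+a≢0 (x+x≡0 a))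
  ... | no a≢b   | yes a+b≡0 = ⊥-elim (a≢b (x+y≡0⇒x≡y a+b≡0))
  ... | no _     | no _      = refl

  φ≡δ₀ : ∀ α γ γ' → φ α γ γ' ≡ δ₀ (γ +F γ' +F α)
  φ≡δ₀ α γ γ' = I_q≡δ₀ (γ +F γ') α

  sumL-δ₀ : ∀ s (h : F → ℕ) → sumL elems (λ c → δ₀ (c +F s) * h c) ≡ h s
  sumL-δ₀ s h = begin
    sumL elems (λ c → δ₀ (c +F s) * h c)
      ≡⟨ sumL-delta _ elems-unique (elems-complete s)
           (λ c c≢s → cong (_* h c) (Iₘ-≢ _≟F_ (c≢s ∘ x+y≡0⇒x≡y))) ⟩
    δ₀ (s +F s) * h s  ≡⟨ cong (λ t → δ₀ t * h s) (x+x≡0 s) ⟩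
    δ₀ 0F * h s        ≡⟨ cong (_* h s) (Iₘ-refl _≟F_ 0F) ⟩
    1 * h s            ≡⟨ ℕ.*-identityˡ (h s) ⟩
    h s                ∎

  sumL-δ₀-affine : ∀ {e} r → e ≢ 0F → sumL elems (λ b → δ₀ (e *F b +F r)) ≡ 1
  sumL-δ₀-affine {e} r e≢0 with inverse e e≢0
  ... | e⁻¹ , e*e⁻¹≡1 = begin
    sumL elems (λ b → δ₀ (e *F b +F r))
      ≡⟨ sumL-delta _ elems-unique (elems-complete (e⁻¹ *F r))
           (λ b b≢b₀ → Iₘ-≢ _≟F_ (b≢b₀ ∘ solution b ∘ x+y≡0⇒x≡y)) ⟩
    δ₀ (e *F (e⁻¹ *F r) +F r)  ≡⟨ cong δ₀ (trans (cong (_+F r) e*[e⁻¹*r]≡r) (x+x≡0 r)) ⟩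
    δ₀ 0F                      ≡⟨ Iₘ-refl _≟F_ 0F ⟩
    1                          ∎
    where
    e*[e⁻¹*r]≡r : e *F (e⁻¹ *F r) ≡ r
    e*[e⁻¹*r]≡r = trans (sym (*-assoc e e⁻¹ r)) (trans (cong (_*F r) e*e⁻¹≡1) (*-identityˡ r))

    solution : ∀ b → e *F b ≡ r → b ≡ e⁻¹ *F r
    solution b e*b≡r = begin
      b                   ≡⟨ sym (*-identityˡ b) ⟩
      1F *F b             ≡⟨ cong (_*F b) (sym (trans (*-comm e⁻¹ e) e*e⁻¹≡1)) ⟩
      (e⁻¹ *F e) *F b     ≡⟨ *-assoc e⁻¹ e b ⟩
      e⁻¹ *F (e *F b)     ≡⟨ cong (e⁻¹ *F_) e*b≡r ⟩
      e⁻¹ *F r            ∎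

  φ-row : ∀ s γ c → φ s γ c ≡ δ₀ (c +F (γ +F s))
  φ-row s γ c = trans (φ≡δ₀ s γ c) (cong δ₀ (solve 3 (λ s γ c → γ :+ c :+ s := c :+ (γ :+ s)) refl s γ c))

  φ-col : ∀ t c γ' → φ t c γ' ≡ δ₀ (c +F (γ' +F t))
  φ-col t c γ' = trans (φ≡δ₀ t c γ') (cong δ₀ (+-assoc c γ' t))

  φ-mul : ∀ s t → mmul elems (φ s) (φ t) ≋ φ (s +F t)
  φ-mul s t γ γ' = begin
    sumL elems (λ c → φ s γ c * φ t c γ')
      ≡⟨ sumL-cong elems (λ c → cong (_* φ t c γ') (φ-row s γ c)) ⟩
    sumL elems (λ c → δ₀ (c +F (γ +F s)) * φ t c γ')
      ≡⟨ sumL-δ₀ (γ +F s) (λ c → φ t c γ') ⟩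
    φ t (γ +F s) γ'
      ≡⟨ trans (φ≡δ₀ t _ γ') (cong δ₀ (solve 4 (λ s t γ γ' → γ :+ s :+ γ' :+ t := γ :+ γ' :+ (s :+ t)) refl s t γ γ')) ⟩
    δ₀ (γ +F γ' +F (s +F t))
      ≡⟨ sym (φ≡δ₀ (s +F t) γ γ') ⟩
    φ (s +F t) γ γ' ∎

  φ-J : ∀ s → mmul elems (φ s) J_q ≋ J_q
  φ-J s γ γ' = trans (sumL-cong elems (λ c → cong (_* 1) (φ-row s γ c))) (sumL-δ₀ (γ +F s) (λ _ → 1))

  J-φ : ∀ t → mmul elems J_q (φ t) ≋ J_q
  J-φ t γ γ' = trans (sumL-cong elems (λ c → trans (ℕ.*-comm 1 _) (cong (_* 1) (φ-col t c γ'))))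
                     (sumL-δ₀ (γ' +F t) (λ _ → 1))

  J-J : mmul elems J_q J_q ≋ q · J_q
  J-J γ γ' = trans (sumL-const elems 1) (cong (_* 1) card)

  Cblock : F → F → F → F → Mat F
  Cblock α α' β β' = φ (α *F ((-F β) +F β') +F α')

  C-fq-square : ∀ α α₁ α₂ → (C (fq α) α₁ ∙² C (fq α) α₂) ≋ q · C (fq α) (α₁ +F α₂)
  C-fq-square α α₁ α₂ (β , γ) (β' , γ') = begin
    (C (fq α) α₁ ∙² C (fq α) α₂) (β , γ) (β' , γ')
      ≡⟨ block-mul elems elems (Cblock α α₁) (Cblock α α₂) β γ β' γ' ⟩
    sumL elems (λ b → mmul elems (Cblock α α₁ β b) (Cblock α α₂ b β') γ γ')
      ≡⟨ sumL-cong elems (λ b → φ-mul _ _ γ γ') ⟩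
    sumL elems (λ b → φ ((α *F ((-F β) +F b) +F α₁) +F (α *F ((-F b) +F β') +F α₂)) γ γ')
      ≡⟨ sumL-cong elems (λ b → cong (λ t → φ t γ γ') (solve 6 (λ α β b β' α₁ α₂ →
            (α :* ((:- β) :+ b) :+ α₁) :+ (α :* ((:- b) :+ β') :+ α₂)
              := α :* ((:- β) :+ β') :+ (α₁ :+ α₂)) refl α β b β' α₁ α₂)) ⟩
    sumL elems (λ _ → Cblock α (α₁ +F α₂) β β' γ γ')
      ≡⟨ trans (sumL-const elems _) (cong (_* _) card) ⟩
    q * Cblock α (α₁ +F α₂) β β' γ γ' ∎

  Jblock : F → F → F → Mat F
  Jblock α β β' = φ α β β' · J_q

  C-y-square : ∀ α₁ α₂ → (C y α₁ ∙² C y α₂) ≋ q · C y (α₁ +F α₂)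
  C-y-square α₁ α₂ (β , γ) (β' , γ') = begin
    (C y α₁ ∙² C y α₂) (β , γ) (β' , γ')
      ≡⟨ block-mul elems elems (Jblock α₁) (Jblock α₂) β γ β' γ' ⟩
    sumL elems (λ b → mmul elems (Jblock α₁ β b) (Jblock α₂ b β') γ γ')
      ≡⟨ sumL-cong elems (λ b → trans (mmul-·ˡ elems J_q (Jblock α₂ b β') (φ α₁ β b) γ γ')
           (cong (φ α₁ β b *_) (trans (mmul-·ʳ elems J_q J_q (φ α₂ b β') γ γ')
             (cong (φ α₂ b β' *_) (J-J γ γ'))))) ⟩
    sumL elems (λ b → φ α₁ β b * (φ α₂ b β' * (q * 1)))
      ≡⟨ sumL-cong elems (λ b → x*[y*z]≡z*[x*y] (φ α₁ β b) (φ α₂ b β') (q * 1)) ⟩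
    sumL elems (λ b → (q * 1) * (φ α₁ β b * φ α₂ b β'))
      ≡⟨ sumL-*ˡ elems (q * 1) _ ⟩
    (q * 1) * mmul elems (φ α₁) (φ α₂) β β'
      ≡⟨ cong ((q * 1) *_) (φ-mul α₁ α₂ β β') ⟩
    (q * 1) * φ (α₁ +F α₂) β β'
      ≡⟨ trans (ℕ.*-assoc q 1 _) (cong (q *_) (ℕ.*-comm 1 _)) ⟩
    q * (φ (α₁ +F α₂) β β' * 1) ∎

  C-fq-fq-product : ∀ {α ε} → α ≢ ε → ∀ α₁ α₂ → (C (fq α) α₁ ∙² C (fq ε) α₂) ≋ J_q²
  C-fq-fq-product {α} {ε} α≢ε α₁ α₂ (β , γ) (β' , γ') = begin
    (C (fq α) α₁ ∙² C (fq ε) α₂) (β , γ) (β' , γ')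
      ≡⟨ block-mul elems elems (Cblock α α₁) (Cblock ε α₂) β γ β' γ' ⟩
    sumL elems (λ b → mmul elems (Cblock α α₁ β b) (Cblock ε α₂ b β') γ γ')
      ≡⟨ sumL-cong elems (λ b → trans (φ-mul _ _ γ γ') (trans (φ≡δ₀ _ γ γ') (cong δ₀ (solve 9
           (λ γ γ' α ε β b β' α₁ α₂ →
              γ :+ γ' :+ ((α :* ((:- β) :+ b) :+ α₁) :+ (ε :* ((:- b) :+ β') :+ α₂))
                := (α :+ ε) :* b :+ (γ :+ γ' :+ α :* β :+ ε :* β' :+ α₁ :+ α₂))
           refl γ γ' α ε β b β' α₁ α₂)))) ⟩
    sumL elems (λ b → δ₀ ((α +F ε) *F b +F (γ +F γ' +F α *F β +F ε *F β' +F α₁ +F α₂)))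
      ≡⟨ sumL-δ₀-affine _ (α≢ε ∘ x+y≡0⇒x≡y) ⟩
    1 ∎

  C-fq-y-product : ∀ α α₁ α₂ → (C (fq α) α₁ ∙² C y α₂) ≋ J_q²
  C-fq-y-product α α₁ α₂ (β , γ) (β' , γ') = begin
    (C (fq α) α₁ ∙² C y α₂) (β , γ) (β' , γ')
      ≡⟨ block-mul elems elems (Cblock α α₁) (Jblock α₂) β γ β' γ' ⟩
    sumL elems (λ b → mmul elems (Cblock α α₁ β b) (Jblock α₂ b β') γ γ')
      ≡⟨ sumL-cong elems (λ b → trans (mmul-·ʳ elems (Cblock α α₁ β b) J_q (φ α₂ b β') γ γ')
           (trans (cong (φ α₂ b β' *_) (φ-J _ γ γ')) (ℕ.*-comm _ 1))) ⟩
    sumL elems (λ b → 1 * φ α₂ b β')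
      ≡⟨ J-φ α₂ β β' ⟩
    1 ∎

  C-y-fq-product : ∀ ε α₁ α₂ → (C y α₁ ∙² C (fq ε) α₂) ≋ J_q²
  C-y-fq-product ε α₁ α₂ (β , γ) (β' , γ') = begin
    (C y α₁ ∙² C (fq ε) α₂) (β , γ) (β' , γ')
      ≡⟨ block-mul elems elems (Jblock α₁) (Cblock ε α₂) β γ β' γ' ⟩
    sumL elems (λ b → mmul elems (Jblock α₁ β b) (Cblock ε α₂ b β') γ γ')
      ≡⟨ sumL-cong elems (λ b → trans (mmul-·ˡ elems J_q (Cblock ε α₂ b β') (φ α₁ β b) γ γ')
           (cong (φ α₁ β b *_) (J-φ _ γ γ'))) ⟩
    sumL elems (λ b → φ α₁ β b * 1)
      ≡⟨ φ-J α₁ β β' ⟩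
    1 ∎

  Iblock : F → F → F → Mat F
  Iblock α β β' = I_q β β' · φ α

  I⊗φ-C-fq : ∀ α α' α'' → ((I_q ⊗ φ α'') ∙² C (fq α) α') ≋ C (fq α) (α' +F α'')
  I⊗φ-C-fq α α' α'' (β , γ) (β' , γ') = begin
    ((I_q ⊗ φ α'') ∙² C (fq α) α') (β , γ) (β' , γ')
      ≡⟨ block-mul elems elems (Iblock α'') (Cblock α α') β γ β' γ' ⟩
    sumL elems (λ b → mmul elems (Iblock α'' β b) (Cblock α α' b β') γ γ')
      ≡⟨ sumL-cong elems (λ b → trans (mmul-·ˡ elems (φ α'') (Cblock α α' b β') (I_q β b) γ γ')
           (cong (I_q β b *_) (φ-mul _ _ γ γ'))) ⟩
    sumL elems (λ b → I_q β b * φ (α'' +F (α *F ((-F b) +F β') +F α')) γ γ')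
      ≡⟨ sumL-Iₘ _≟F_ β _ elems-unique (elems-complete β) ⟩
    φ (α'' +F (α *F ((-F β) +F β') +F α')) γ γ'
      ≡⟨ cong (λ t → φ t γ γ') (solve 5 (λ α'' α β β' α' →
           α'' :+ (α :* ((:- β) :+ β') :+ α') := α :* ((:- β) :+ β') :+ (α' :+ α''))
           refl α'' α β β' α') ⟩
    Cblock α (α' +F α'') β β' γ γ' ∎

  I⊗φ-C-y : ∀ α α' → ((I_q ⊗ φ α) ∙² C y α') ≋ C y α'
  I⊗φ-C-y α α' (β , γ) (β' , γ') = begin
    ((I_q ⊗ φ α) ∙² C y α') (β , γ) (β' , γ')
      ≡⟨ block-mul elems elems (Iblock α) (Jblock α') β γ β' γ' ⟩
    sumL elems (λ b → mmul elems (Iblock α β b) (Jblock α' b β') γ γ')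
      ≡⟨ sumL-cong elems (λ b → trans (mmul-·ˡ elems (φ α) (Jblock α' b β') (I_q β b) γ γ') (cong (I_q β b *_)
           (trans (mmul-·ʳ elems (φ α) J_q (φ α' b β') γ γ') (cong (φ α' b β' *_) (φ-J α γ γ'))))) ⟩
    sumL elems (λ b → I_q β b * (φ α' b β' * 1))
      ≡⟨ sumL-Iₘ _≟F_ β _ elems-unique (elems-complete β) ⟩
    φ α' β β' * 1 ∎

  sumL-Cblock-diagonal : ∀ α β γ γ' → sumL elems (λ a → Cblock a α β β γ γ') ≡ q * φ α γ γ'
  sumL-Cblock-diagonal α β γ γ' = begin
    sumL elems (λ a → Cblock a α β β γ γ')
      ≡⟨ sumL-cong elems (λ a → cong (λ t → φ t γ γ')
           (solve 3 (λ a β α → a :* ((:- β) :+ β) :+ α := α) refl a β α)) ⟩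
    sumL elems (λ _ → φ α γ γ')
      ≡⟨ trans (sumL-const elems _) (cong (_* _) card) ⟩
    q * φ α γ γ' ∎

  sumL-Cblock-offDiagonal : ∀ α {β β'} → β ≢ β' → ∀ γ γ' → sumL elems (λ a → Cblock a α β β' γ γ') ≡ 1
  sumL-Cblock-offDiagonal α {β} {β'} β≢β' γ γ' = begin
    sumL elems (λ a → Cblock a α β β' γ γ')
      ≡⟨ sumL-cong elems (λ a → trans (φ≡δ₀ _ γ γ') (cong δ₀
           (solve 6 (λ γ γ' a β β' α → γ :+ γ' :+ (a :* ((:- β) :+ β') :+ α)
                                         := (β :+ β') :* a :+ (γ :+ γ' :+ α)) refl γ γ' a β β' α))) ⟩
    sumL elems (λ a → δ₀ ((β +F β') *F a +F (γ +F γ' +F α)))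
      ≡⟨ sumL-δ₀-affine _ (β≢β' ∘ x+y≡0⇒x≡y) ⟩
    1 ∎

  C-sum : ∀ α → msum elemsFy (λ a → C a α) ≋ (q · (I_q ⊗ φ α)) ⊕ (((J_q ⊕ φ α) ⊖ I_q) ⊗ J_q)
  C-sum α (β , γ) (β' , γ') with β ≟F β'
  ... | yes refl = begin
    sumL (map fq elems ++ y ∷ []) (λ a → C a α (β , γ) (β , γ'))
      ≡⟨ trans (sumL-++ (map fq elems) (y ∷ []) _) (cong (_+ _) (sumL-map fq elems _)) ⟩
    sumL elems (λ a → Cblock a α β β γ γ') + (φ α β β * 1 + 0)
      ≡⟨ cong₂ _+_ (sumL-Cblock-diagonal α β γ γ') (ℕ.+-identityʳ _) ⟩
    q * φ α γ γ' + φ α β β * 1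
      ≡⟨ cong (λ i → q * i + φ α β β * 1) (sym (ℕ.*-identityˡ _)) ⟩
    q * (1 * φ α γ γ') + ((1 + φ α β β) ∸ 1) * 1 ∎
  ... | no β≢β' = begin
    sumL (map fq elems ++ y ∷ []) (λ a → C a α (β , γ) (β' , γ'))
      ≡⟨ trans (sumL-++ (map fq elems) (y ∷ []) _) (cong (_+ _) (sumL-map fq elems _)) ⟩
    sumL elems (λ a → Cblock a α β β' γ γ') + (φ α β β' * 1 + 0)
      ≡⟨ cong₂ _+_ (sumL-Cblock-offDiagonal α β≢β' γ γ') (ℕ.+-identityʳ _) ⟩
    1 + φ α β β' * 1
      ≡⟨ cong (_+ (1 + φ α β β' * 1)) (sym (ℕ.*-zeroʳ q)) ⟩
    q * (0 * φ α γ γ') + ((1 + φ α β β') ∸ 0) * 1 ∎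

  C-square : ∀ a → a ≢ x → ∀ α α' → (C a α ∙² C a α') ≋ q · C a (α +F α')
  C-square (fq α) _   = C-fq-square α
  C-square y      _   = C-y-square
  C-square x      x≢x = ⊥-elim (x≢x refl)

  C-product : ∀ a a' → a ≢ x → a' ≢ x → a ≢ a' → ∀ α α' → (C a α ∙² C a' α') ≋ J_q²
  C-product (fq α) (fq ε) _   _    a≢a' = C-fq-fq-product (a≢a' ∘ cong fq)
  C-product (fq α) y      _   _    _    = C-fq-y-product α
  C-product y      (fq ε) _   _    _    = C-y-fq-product ε
  C-product y      y      _   _    y≢y  = ⊥-elim (y≢y refl)
  C-product x      _      x≢x _    _    = ⊥-elim (x≢x refl)
  C-product _      x      _   x≢x  _    = ⊥-elim (x≢x refl)

  fq∈⇒≢x : ∀ {a} → a ∈ map fq elems → a ≢ x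
  fq∈⇒≢x a∈ a≡x with ∈-map⁻ fq a∈
  fq∈⇒≢x a∈ refl | _ , _ , ()

  fq∈⇒≢y : ∀ {a} → a ∈ map fq elems → a ≢ y
  fq∈⇒≢y a∈ a≡y with ∈-map⁻ fq a∈
  fq∈⇒≢y a∈ refl | _ , _ , ()

  map-fq-unique : Unique (map fq elems)
  map-fq-unique = Unique.map⁺ fq-injective elems-unique

  elemsS-unique : Unique elemsS
  elemsS-unique = Unique.++⁺ map-fq-unique (((λ ()) ∷ []) ∷ [] ∷ []) λ where
    (a∈ , here a≡x)         → fq∈⇒≢x a∈ a≡x
    (a∈ , there (here a≡y)) → fq∈⇒≢y a∈ a≡y

  elemsFy-unique : Unique elemsFy
  elemsFy-unique = Unique.++⁺ map-fq-unique ([] ∷ []) λ where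
    (a∈ , here a≡y) → fq∈⇒≢y a∈ a≡y

  ∈elemsS : ∀ a → a ∈ elemsS
  ∈elemsS (fq a) = ∈-++⁺ˡ (∈-map⁺ fq (elems-complete a))
  ∈elemsS x      = ∈-++⁺ʳ (map fq elems) (here refl)
  ∈elemsS y      = ∈-++⁺ʳ (map fq elems) (there (here refl))

  ∈elemsFy : ∀ a → a ≢ x → a ∈ elemsFy
  ∈elemsFy (fq a) _   = ∈-++⁺ˡ (∈-map⁺ fq (elems-complete a))
  ∈elemsFy x      x≢x = ⊥-elim (x≢x refl)
  ∈elemsFy y      _   = ∈-++⁺ʳ (map fq elems) (here refl)

  ∈elemsFy⇒≢x : ∀ {a} → a ∈ elemsFy → a ≢ x
  ∈elemsFy⇒≢x a∈ with ∈-++⁻ (map fq elems) a∈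
  ... | inj₁ a∈fq        = fq∈⇒≢x a∈fq
  ... | inj₂ (here refl) = λ ()

  |elemsS| : length elemsS ≡ q + 2
  |elemsS| = trans (length-++ (map fq elems)) (cong (_+ 2) (trans (length-map fq elems) card))

  pairTerm : Sq → Sq → Sq → Sq → ℕ
  pairTerm s t a b = if ⌊ a ≟S b ⌋ then 0 else I_S s a * I_S t b

  pairCount : Sq → Sq → ℕ
  pairCount s t = sumL elemsFy (λ a → sumL elemsFy (pairTerm s t a))

  pairTerm-≢ˡ : ∀ {s a} t b → a ≢ s → pairTerm s t a b ≡ 0
  pairTerm-≢ˡ {s} {a} t b a≢s with ⌊ a ≟S b ⌋
  ... | true  = refl
  ... | false = cong (_* I_S t b) (Iₘ-≢ _≟S_ (a≢s ∘ sym))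

  pairTerm-≢ʳ : ∀ {t b} s a → b ≢ t → pairTerm s t a b ≡ 0
  pairTerm-≢ʳ {t} {b} s a b≢t with ⌊ a ≟S b ⌋
  ... | true  = refl
  ... | false = trans (cong (I_S s a *_) (Iₘ-≢ _≟S_ (b≢t ∘ sym))) (ℕ.*-zeroʳ (I_S s a))

  pairCount-xˡ : ∀ t → pairCount x t ≡ 0
  pairCount-xˡ t = sumL-vanishing elemsFy _ (λ a a∈ →
    sumL-vanishing elemsFy _ (λ b _ → pairTerm-≢ˡ t b (∈elemsFy⇒≢x a∈)))

  pairCount-xʳ : ∀ s → pairCount s x ≡ 0
  pairCount-xʳ s = sumL-vanishing elemsFy _ (λ a _ →
    sumL-vanishing elemsFy _ (λ b b∈ → pairTerm-≢ʳ s a (∈elemsFy⇒≢x b∈)))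

  pairCount-≢x : ∀ {s t} → s ≢ x → t ≢ x → pairCount s t ≡ pairTerm s t s t
  pairCount-≢x {s} {t} s≢x t≢x =
    trans (sumL-delta _ elemsFy-unique (∈elemsFy s s≢x)
            (λ a a≢s → sumL-vanishing elemsFy _ (λ b _ → pairTerm-≢ˡ t b a≢s)))
          (sumL-delta _ elemsFy-unique (∈elemsFy t t≢x) (λ b b≢t → pairTerm-≢ʳ s s b≢t))

  pairCount-diagonal : ∀ s → pairCount s s ≡ 0
  pairCount-diagonal s with s ≟S x
  ... | yes refl = pairCount-xˡ x
  ... | no s≢x   = trans (pairCount-≢x s≢x s≢x) equal
    where
    equal : pairTerm s s s s ≡ 0
    equal with s ≟S s
    ... | yes _  = refl
    ... | no s≢s = ⊥-elim (s≢s refl)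

  pairCount-distinct : ∀ {s t} → s ≢ x → t ≢ x → s ≢ t → pairCount s t ≡ 1
  pairCount-distinct {s} {t} s≢x t≢x s≢t = trans (pairCount-≢x s≢x t≢x) distinct
    where
    distinct : pairTerm s t s t ≡ 1
    distinct with s ≟S t
    ... | yes s≡t = ⊥-elim (s≢t s≡t)
    ... | no _    = cong₂ _*_ (Iₘ-refl _≟S_ s) (Iₘ-refl _≟S_ t)

  module LatinSquare (L : Sq → Sq → Sq) (latin : IsLatinSquare L)
                     (L-sym : ∀ a b → L a b ≡ L b a) (L-diag : ∀ a → L a a ≡ x) where

    row-injective : ∀ {u w w'} → L u w ≡ L u w' → w ≡ w'
    row-injective {u} {w} {w'} eq with proj₁ latin u (L u w')
    ... | _ , _ , unique = trans (unique w eq) (sym (unique w' refl))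

    column-injective : ∀ {u v w} → L u w ≡ L v w → u ≡ v
    column-injective {u} {v} {w} eq with proj₂ latin w (L v w)
    ... | _ , _ , unique = trans (unique u eq) (sym (unique v refl))

    -- P L a u w is definitionally I_S (L u w) a.
    summand : ∀ u v a b →
      (if ⌊ a ≟S b ⌋ then Oₘ else (P L a ∙S P L b)) u v ≡ sumL elemsS (λ w → pairTerm (L u w) (L w v) a b)
    summand u v a b with ⌊ a ≟S b ⌋
    ... | true  = sym (sumL-vanishing elemsS _ (λ _ _ → refl))
    ... | false = refl

    ΣPP-pairCount : ∀ u v → ΣPP L u v ≡ sumL elemsS (λ w → pairCount (L u w) (L w v))
    ΣPP-pairCount u v = begin
      ΣPP L u v
        ≡⟨ sumL-cong elemsFy (λ a → sumL-cong elemsFy (summand u v a)) ⟩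
      sumL elemsFy (λ a → sumL elemsFy (λ b → sumL elemsS (λ w → pairTerm (L u w) (L w v) a b)))
        ≡⟨ sumL-cong elemsFy (λ a → sumL-comm elemsFy elemsS _) ⟩
      sumL elemsFy (λ a → sumL elemsS (λ w → sumL elemsFy (pairTerm (L u w) (L w v) a)))
        ≡⟨ sumL-comm elemsFy elemsS _ ⟩
      sumL elemsS (λ w → pairCount (L u w) (L w v)) ∎

    pairCount-offDiagonal : ∀ {u v} → u ≢ v → ∀ w →
      pairCount (L u w) (L w v) + (I_S u w + I_S v w) ≡ 1
    pairCount-offDiagonal {u} {v} u≢v w with w ≟S u | w ≟S v
    ... | yes refl | _ = cong₂ _+_ (trans (cong (λ s → pairCount s (L u v)) (L-diag u)) (pairCount-xˡ (L u v)))
                                   (cong₂ _+_ (Iₘ-refl _≟S_ u) (Iₘ-≢ _≟S_ (u≢v ∘ sym)))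
    ... | no w≢u | yes refl = cong₂ _+_ (trans (cong (pairCount (L u v)) (L-diag v)) (pairCount-xʳ (L u v)))
                                        (cong₂ _+_ (Iₘ-≢ _≟S_ u≢v) (Iₘ-refl _≟S_ v))
    ... | no w≢u | no w≢v = cong₂ _+_ (pairCount-distinct Luw≢x Lwv≢x Luw≢Lwv)
                                      (cong₂ _+_ (Iₘ-≢ _≟S_ (w≢u ∘ sym)) (Iₘ-≢ _≟S_ (w≢v ∘ sym)))
      where
      Luw≢x : L u w ≢ x
      Luw≢x eq = w≢u (row-injective (trans eq (sym (L-diag u))))
      Lwv≢x : L w v ≢ x
      Lwv≢x eq = w≢v (column-injective (trans eq (sym (L-diag v))))
      Luw≢Lwv : L u w ≢ L w v
      Luw≢Lwv eq = u≢v (column-injective (trans eq (L-sym w v)))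

    sumL-pairCount-offDiagonal : ∀ {u v} → u ≢ v → sumL elemsS (λ w → pairCount (L u w) (L w v)) ≡ q
    sumL-pairCount-offDiagonal {u} {v} u≢v = ℕ.+-cancelʳ-≡ 2 total q (begin
      total + (1 + 1)
        ≡⟨ cong (total +_) (sym (cong₂ _+_ (sumL-Iₘ-row _≟S_ u elemsS-unique (∈elemsS u))
                                       (sumL-Iₘ-row _≟S_ v elemsS-unique (∈elemsS v)))) ⟩
      total + (sumL elemsS (I_S u) + sumL elemsS (I_S v))
        ≡⟨ cong (total +_) (sym (sumL-+ elemsS (I_S u) (I_S v))) ⟩
      total + sumL elemsS (λ w → I_S u w + I_S v w)
        ≡⟨ sym (sumL-+ elemsS _ _) ⟩
      sumL elemsS (λ w → pairCount (L u w) (L w v) + (I_S u w + I_S v w))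
        ≡⟨ sumL-cong elemsS (pairCount-offDiagonal u≢v) ⟩
      sumL elemsS (λ _ → 1)
        ≡⟨ trans (sumL-const elemsS 1) (trans (ℕ.*-identityʳ _) |elemsS|) ⟩
      q + 2 ∎)
      where
      total : ℕ
      total = sumL elemsS (λ w → pairCount (L u w) (L w v))

    ΣPP-value : ΣPP L ≋ q · (J_S ⊖ I_S)
    ΣPP-value u v with u ≟S v
    ... | yes refl = trans (ΣPP-pairCount u u)
                       (trans (sumL-vanishing elemsS _ (λ w _ →
                                 trans (cong (pairCount (L u w)) (L-sym w u)) (pairCount-diagonal (L u w))))
                              (sym (ℕ.*-zeroʳ q)))
    ... | no u≢v   = trans (ΣPP-pairCount u v)
                       (trans (sumL-pairCount-offDiagonal u≢v) (sym (ℕ.*-identityʳ q)))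

lemma3p1 :
    (m : ℕ) → 1 ≤ m → (𝔽 : FiniteField2^ m) →
    let open FiniteField2^ 𝔽
        open Construction 𝔽
    in (L : Sq → Sq → Sq) → IsLatinSquare L →
       (∀ a b → L a b ≡ L b a) → (∀ a → L a a ≡ x) →
       -- (i)
       (∀ α → msum elemsFy (λ a → C a α)
                ≋ (q · (I_q ⊗ φ α)) ⊕ (((J_q ⊕ φ α) ⊖ I_q) ⊗ J_q))
       -- (ii)
       × (∀ a → a ≢ x → ∀ α α' → (C a α ∙² C a α') ≋ q · C a (α +F α'))
       -- (iii)
       × (∀ a a' → a ≢ x → a' ≢ x → a ≢ a' → ∀ α α' →
            (C a α ∙² C a' α') ≋ J_q²)
       -- (iv)
       × (∀ α α' α'' → ((I_q ⊗ φ α'') ∙² C (fq α) α') ≋ C (fq α) (α' +F α''))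
       -- (v)
       × (∀ α α' → ((I_q ⊗ φ α) ∙² C y α') ≋ C y α')
       -- (vi)
       × (ΣPP L ≋ q · (J_S ⊖ I_S))
lemma3p1 m _ 𝔽 L latin L-sym L-diag =
  C-sum , C-square , C-product , I⊗φ-C-fq , I⊗φ-C-y , ΣPP-value
  where
  open FiniteFieldMatrices 𝔽
  open LatinSquare L latin L-sym L-diag
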